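{- Let $q$ be an odd prime power, $m\ge0$, $c_0,\ldots,c_m\in\mathbb F_q$ with $c_m\ne0$, $A(z)=c_0+\frac12\sum_{l=1}^m c_l(z^l+z^{ -l})$ and $P(z)=z^mA(z)\in\mathbb F_q[z]$. Let $g=z^rg_0$ with $r\ge0$, $g_0\in\mathbb F_q[z]$ non-zero and $g_0(0)\ne0$; put $d_0=\deg g_0+m$ and $F_{g_0}(z)=P(z)g_0(z)g_0^*(z)$. Let $N\ge0$ and consider the bilinear form \[ B_{g,N}(h,w)=\operatorname{CT}\bigl(A(z)g(z)h(z)g(z^{ -1})w(z^{ -1})\bigr),\qquad h,w\in V_N. \] Then $h\in V_N$ lies in the radical of $B_{g,N}$ (i.e. $B_{g,N}(h,w)=0$ for all $w\in V_N$) if and only if \[ [z^j]\,F_{g_0}(z)h(z)=0\qquad\text{for all } d_0\le j\le d_0+N. \]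
   Context: $V_N=\{h\in\mathbb F_q[z]:\deg h\le N\}$. $\operatorname{CT}$ denotes the constant term of a Laurent polynomial, and $[z^j]F$ the coefficient of $z^j$ in $F$. For a polynomial $a$ of degree $k$, $a^*(z)=z^ka(z^{ -1})$. -}

module Defs where

open import Level using (Level)
open import Algebra.Bundles using (CommutativeRing)
open import Data.Nat using (ℕ; zero; suc; _∸_) renaming (_+_ to _+ℕ_)
open import Data.List using (List; []; _∷_; map; reverse; length; replicate; _++_)
open import Data.Vec using (Vec)
open import Data.Fin using (Fin)
open import Data.Product using (Σ; ∃)
open import Relation.Nullary using (¬_)

-- Finite field structure on a commutative ring (F_q for some prime power q
-- is exactly a finite field); odd characteristic is stated separately.
record IsFiniteField {c ℓ : Level} (R : CommutativeRing c ℓ) : Set (c Level.⊔ ℓ) where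
  open CommutativeRing R
  field
    nontrivial : ¬ (1# ≈ 0#)
    inverse    : ∀ x → ¬ (x ≈ 0#) → Σ Carrier (λ y → x * y ≈ 1#)
    size       : ℕ
    enum       : Fin size → Carrier
    enum-onto  : ∀ x → ∃ (λ i → enum i ≈ x)

module Poly {c ℓ : Level} (R : CommutativeRing c ℓ) where
  open CommutativeRing R

  -- polynomials as coefficient lists, lowest degree first
  Pol : Set c
  Pol = List Carrier

  _+ₚ_ : Pol → Pol → Pol
  [] +ₚ q = q
  (a ∷ p) +ₚ [] = a ∷ p
  (a ∷ p) +ₚ (b ∷ q) = (a + b) ∷ (p +ₚ q)

  _*ₚ_ : Pol → Pol → Pol
  [] *ₚ q = []
  (a ∷ p) *ₚ q = map (a *_) q +ₚ (0# ∷ (p *ₚ q))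

  coeff : Pol → ℕ → Carrier
  coeff [] j = 0#
  coeff (a ∷ p) zero = a
  coeff (a ∷ p) (suc j) = coeff p j

  -- Laurent polynomial z^{-shift} · body(z)
  record Laurent : Set c where
    constructor laurent
    field
      shift : ℕ
      body  : Pol

  _*ₗ_ : Laurent → Laurent → Laurent
  laurent s p *ₗ laurent t q = laurent (s +ℕ t) (p *ₚ q)

  poly : Pol → Laurent
  poly p = laurent 0 p

  -- p(z^{-1}) = z^{-(length p - 1)} · (reverse p)(z)
  invZ : Pol → Laurent
  invZ p = laurent (length p ∸ 1) (reverse p)

  CT : Laurent → Carrier
  CT (laurent s p) = coeff p s

  -- V_N elements: coefficient vectors of length N+1
  vpol : ∀ {n} → Vec Carrier n → Pol
  vpol = Data.Vec.toList

  -- P(z) = z^m A(z) with A(z) = c₀ + ½ Σ_{l=1}^m c_l (z^l + z^{-l});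
  -- given c₀ and cs = (c₁,…,c_m), and half = 1/2.
  Pcoeffs : ∀ {m} → Carrier → Carrier → Vec Carrier m → Pol
  Pcoeffs half c₀ cs = reverse (map (half *_) (vpol cs)) ++ (c₀ ∷ map (half *_) (vpol cs))

  Alaurent : ∀ m → Carrier → Carrier → Vec Carrier m → Laurent
  Alaurent m half c₀ cs = laurent m (Pcoeffs half c₀ cs)

  gpol : ∀ {e} → ℕ → Vec Carrier e → Pol
  gpol r g₀ = replicate r 0# ++ vpol g₀

  -- a^*(z) = z^{deg a} a(z^{-1}) (for a with nonzero leading coefficient)
  star : Pol → Pol
  star = reverse

  B : Laurent → Pol → Pol → Pol → Carrier
  B A g h w = CT ((((A *ₗ poly g) *ₗ poly h) *ₗ invZ g) *ₗ invZ w)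

{-# OPTIONS --safe #-}
-- With g = z^r g₀, unfolding the definitions shows that B(h, w) is the coefficient of
-- z^(m+r+e+N) in P g h g* w*.  Since w* = z^N w(z⁻¹), that coefficient pairs w_k with the
-- coefficient of P g h g* at m+r+e+k, and the factor z^r of g only shifts indices, so
-- B(h, w) = Σ_k w_k [z^(d₀+k)] F_{g₀} h.  Such a linear form in w vanishes identically iff
-- all its coefficients do.  Everything holds over an arbitrary commutative ring.
module Submission where

open import Defs
open import Level using (Level)
open import Algebra.Bundles using (CommutativeRing)
open import Data.Nat using (ℕ; zero; suc; _≤_; _<_; _∸_; s≤s; z<s; s<s) renaming (_+_ to _+ℕ_)
open import Data.Vec using (Vec; []; _∷_; head; last; toList)
open import Data.Product using (_×_; _,_)
open import Relation.Nullary using (¬_)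

import Algebra.Properties.CommutativeSemigroup as CommutativeSemigroupProperties
open import Data.Fin using (Fin; zero; suc; toℕ; fromℕ<)
open import Data.Fin.Properties using (toℕ-fromℕ<)
open import Data.List using (List; []; _∷_; map; drop; reverse; length; replicate; _++_; _∷ʳ_)
open import Data.List.Properties using (unfold-reverse; length-reverse; reverse-++; length-++; length-replicate)
open import Data.List.Relation.Unary.All using (All; []; _∷_)
open import Data.List.Relation.Unary.All.Properties using (replicate⁺)
open import Data.List.Relation.Binary.Permutation.Propositional using (↭-sym)
open import Data.List.Relation.Binary.Permutation.Propositional.Properties using (↭-reverse; All-resp-↭)
import Data.Nat.Properties as ℕ
open import Data.Nat.Tactic.RingSolver using (solve-∀)
import Data.Vec as Vec
open import Data.Vec.Properties using (length-toList)
open import Function.Base using (_∘_)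
open import Function.Bundles using (_⇔_; mk⇔; module Equivalence)
open import Function.Construct.Composition using (_⇔-∘_)
open import Relation.Binary.Bundles using (Setoid)
open import Relation.Binary.Structures using (IsEquivalence)
open import Relation.Binary.PropositionalEquality as ≡ using (_≡_)

module Polynomials {c ℓ : Level} (R : CommutativeRing c ℓ) where
  open CommutativeRing R
  open Poly R
  open CommutativeSemigroupProperties +-commutativeSemigroup using (x∙yz≈y∙xz; interchange)
  open import Relation.Binary.Reasoning.Setoid setoid

  -- Coefficient lists are not normalised, so they are compared coefficientwise: trailing
  -- zeros are invisible to _≋_.
  infix 4 _≋_
  record _≋_ (p q : Pol) : Set ℓ where
    constructor mk≋
    field at : ∀ n → coeff p n ≈ coeff q n
  open _≋_ public

  ≋-isEquivalence : IsEquivalence _≋_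
  ≋-isEquivalence = record
    { refl  = mk≋ λ _ → refl
    ; sym   = λ p≋q → mk≋ λ n → sym (at p≋q n)
    ; trans = λ p≋q q≋s → mk≋ λ n → trans (at p≋q n) (at q≋s n)
    }

  ≋-setoid : Setoid c ℓ
  ≋-setoid = record { isEquivalence = ≋-isEquivalence }

  open IsEquivalence ≋-isEquivalence public
    using () renaming (refl to ≋-refl; sym to ≋-sym; trans to ≋-trans; reflexive to ≋-reflexive)

  ∷-cong : ∀ {a b p q} → a ≈ b → p ≋ q → a ∷ p ≋ b ∷ q
  ∷-cong a≈b p≋q .at zero    = a≈b
  ∷-cong a≈b p≋q .at (suc n) = at p≋q n

  coeff-+ₚ : ∀ p q n → coeff (p +ₚ q) n ≈ coeff p n + coeff q n
  coeff-+ₚ []      q       n       = sym (+-identityˡ _)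
  coeff-+ₚ (a ∷ p) []      n       = sym (+-identityʳ _)
  coeff-+ₚ (a ∷ p) (b ∷ q) zero    = refl
  coeff-+ₚ (a ∷ p) (b ∷ q) (suc n) = coeff-+ₚ p q n

  coeff-map-* : ∀ a p n → coeff (map (a *_) p) n ≈ a * coeff p n
  coeff-map-* a []      n       = sym (zeroʳ a)
  coeff-map-* a (b ∷ p) zero    = refl
  coeff-map-* a (b ∷ p) (suc n) = coeff-map-* a p n

  coeff-drop-1 : ∀ p n → coeff (drop 1 p) n ≡ coeff p (suc n)
  coeff-drop-1 []      n = ≡.refl
  coeff-drop-1 (a ∷ p) n = ≡.refl

  coeff-replicate-++ : ∀ r a p n → coeff (replicate r a ++ p) (r +ℕ n) ≡ coeff p n
  coeff-replicate-++ zero    a p n = ≡.refl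
  coeff-replicate-++ (suc r) a p n = coeff-replicate-++ r a p n

  ++-≋[] : ∀ p {zs} → zs ≋ [] → p ++ zs ≋ p
  ++-≋[] []      zs≋[] = zs≋[]
  ++-≋[] (a ∷ p) zs≋[] = ∷-cong refl (++-≋[] p zs≋[])

  All≈0⇒≋[] : ∀ {zs} → All (_≈ 0#) zs → zs ≋ []
  All≈0⇒≋[] []           = ≋-refl
  All≈0⇒≋[] (z≈0 ∷ zs≈0) .at zero    = z≈0
  All≈0⇒≋[] (z≈0 ∷ zs≈0) .at (suc n) = at (All≈0⇒≋[] zs≈0) n

  +ₚ-cong : ∀ {p p' q q'} → p ≋ p' → q ≋ q' → p +ₚ q ≋ p' +ₚ q'
  +ₚ-cong {p} {p'} {q} {q'} p≋p' q≋q' .at n = begin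
    coeff (p +ₚ q) n          ≈⟨ coeff-+ₚ p q n ⟩
    coeff p n + coeff q n     ≈⟨ +-cong (at p≋p' n) (at q≋q' n) ⟩
    coeff p' n + coeff q' n   ≈⟨ coeff-+ₚ p' q' n ⟨
    coeff (p' +ₚ q') n        ∎

  map-0*-+ₚ : ∀ p q → map (0# *_) p +ₚ q ≋ q
  map-0*-+ₚ p q .at n = begin
    coeff (map (0# *_) p +ₚ q) n          ≈⟨ coeff-+ₚ (map (0# *_) p) q n ⟩
    coeff (map (0# *_) p) n + coeff q n   ≈⟨ +-congʳ (trans (coeff-map-* 0# p n) (zeroˡ _)) ⟩
    0# + coeff q n                        ≈⟨ +-identityˡ _ ⟩
    coeff q n                             ∎

  coeff-*ₚ-zero : ∀ p q → coeff (p *ₚ q) 0 ≈ coeff p 0 * coeff q 0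
  coeff-*ₚ-zero []      q = sym (zeroˡ _)
  coeff-*ₚ-zero (a ∷ p) q = trans (coeff-+ₚ (map (a *_) q) _ 0) (trans (+-identityʳ _) (coeff-map-* a q 0))

  coeff-*ₚ-suc : ∀ p q n → coeff (p *ₚ q) (suc n) ≈ coeff p 0 * coeff q (suc n) + coeff (drop 1 p *ₚ q) n
  coeff-*ₚ-suc []      q n = sym (trans (+-identityʳ _) (zeroˡ _))
  coeff-*ₚ-suc (a ∷ p) q n = trans (coeff-+ₚ (map (a *_) q) _ (suc n)) (+-congʳ (coeff-map-* a q (suc n)))

  drop-1-cong : ∀ {p p'} → p ≋ p' → drop 1 p ≋ drop 1 p'
  drop-1-cong {p} {p'} p≋p' .at n = begin
    coeff (drop 1 p) n    ≡⟨ coeff-drop-1 p n ⟩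
    coeff p (suc n)       ≈⟨ at p≋p' (suc n) ⟩
    coeff p' (suc n)      ≡⟨ coeff-drop-1 p' n ⟨
    coeff (drop 1 p') n   ∎

  *ₚ-congˡ : ∀ {p p'} q → p ≋ p' → p *ₚ q ≋ p' *ₚ q
  *ₚ-congˡ q p≋p' = mk≋ λ n → coeff-*ₚ-congˡ n p≋p'
    where
    coeff-*ₚ-congˡ : ∀ n {p p'} → p ≋ p' → coeff (p *ₚ q) n ≈ coeff (p' *ₚ q) n
    coeff-*ₚ-congˡ zero {p} {p'} p≋p' = begin
      coeff (p *ₚ q) 0          ≈⟨ coeff-*ₚ-zero p q ⟩
      coeff p 0 * coeff q 0     ≈⟨ *-congʳ (at p≋p' 0) ⟩
      coeff p' 0 * coeff q 0    ≈⟨ coeff-*ₚ-zero p' q ⟨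
      coeff (p' *ₚ q) 0         ∎
    coeff-*ₚ-congˡ (suc n) {p} {p'} p≋p' = begin
      coeff (p *ₚ q) (suc n)
        ≈⟨ coeff-*ₚ-suc p q n ⟩
      coeff p 0 * coeff q (suc n) + coeff (drop 1 p *ₚ q) n
        ≈⟨ +-cong (*-congʳ (at p≋p' 0)) (coeff-*ₚ-congˡ n (drop-1-cong p≋p')) ⟩
      coeff p' 0 * coeff q (suc n) + coeff (drop 1 p' *ₚ q) n
        ≈⟨ coeff-*ₚ-suc p' q n ⟨
      coeff (p' *ₚ q) (suc n)
        ∎

  *ₚ-zeroʳ : ∀ p → p *ₚ [] ≋ []
  *ₚ-zeroʳ []      = ≋-refl
  *ₚ-zeroʳ (a ∷ p) .at zero    = refl
  *ₚ-zeroʳ (a ∷ p) .at (suc n) = at (*ₚ-zeroʳ p) n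

  *ₚ-∷ʳ : ∀ p a q → p *ₚ (a ∷ q) ≋ map (a *_) p +ₚ (0# ∷ (p *ₚ q))
  *ₚ-∷ʳ []      a q .at zero    = refl
  *ₚ-∷ʳ []      a q .at (suc n) = refl
  *ₚ-∷ʳ (b ∷ p) a q .at zero    = +-congʳ (*-comm b a)
  *ₚ-∷ʳ (b ∷ p) a q .at (suc n) = begin
    coeff (map (b *_) q +ₚ (p *ₚ (a ∷ q))) n
      ≈⟨ coeff-+ₚ (map (b *_) q) _ n ⟩
    coeff (map (b *_) q) n + coeff (p *ₚ (a ∷ q)) n
      ≈⟨ +-congˡ (trans (at (*ₚ-∷ʳ p a q) n) (coeff-+ₚ (map (a *_) p) _ n)) ⟩
    coeff (map (b *_) q) n + (coeff (map (a *_) p) n + coeff (0# ∷ (p *ₚ q)) n)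
      ≈⟨ x∙yz≈y∙xz _ _ _ ⟩
    coeff (map (a *_) p) n + (coeff (map (b *_) q) n + coeff (0# ∷ (p *ₚ q)) n)
      ≈⟨ +-congˡ (coeff-+ₚ (map (b *_) q) _ n) ⟨
    coeff (map (a *_) p) n + coeff ((b ∷ p) *ₚ q) n
      ≈⟨ coeff-+ₚ (map (a *_) p) _ n ⟨
    coeff (map (a *_) p +ₚ ((b ∷ p) *ₚ q)) n
      ∎

  *ₚ-comm : ∀ p q → p *ₚ q ≋ q *ₚ p
  *ₚ-comm []      q = ≋-sym (*ₚ-zeroʳ q)
  *ₚ-comm (a ∷ p) q = ≋-trans (+ₚ-cong ≋-refl (∷-cong refl (*ₚ-comm p q))) (≋-sym (*ₚ-∷ʳ q a p))

  *ₚ-congʳ : ∀ p {q q'} → q ≋ q' → p *ₚ q ≋ p *ₚ q'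
  *ₚ-congʳ p {q} {q'} q≋q' = ≋-trans (*ₚ-comm p q) (≋-trans (*ₚ-congˡ p q≋q') (*ₚ-comm q' p))

  coeff-∷-*ₚ : ∀ a p q n → coeff ((a ∷ p) *ₚ q) n ≈ a * coeff q n + coeff (0# ∷ (p *ₚ q)) n
  coeff-∷-*ₚ a p q n = trans (coeff-+ₚ (map (a *_) q) _ n) (+-congʳ (coeff-map-* a q n))

  *ₚ-0∷ˡ : ∀ p q → (0# ∷ p) *ₚ q ≋ 0# ∷ (p *ₚ q)
  *ₚ-0∷ˡ p q = map-0*-+ₚ q (0# ∷ (p *ₚ q))

  *ₚ-0∷ʳ : ∀ p q → p *ₚ (0# ∷ q) ≋ 0# ∷ (p *ₚ q)
  *ₚ-0∷ʳ p q = ≋-trans (*ₚ-∷ʳ p 0# q) (map-0*-+ₚ p (0# ∷ (p *ₚ q)))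

  *ₚ-distribʳ-+ₚ : ∀ p q r → (p +ₚ q) *ₚ r ≋ (p *ₚ r) +ₚ (q *ₚ r)
  *ₚ-distribʳ-+ₚ []      q       r = ≋-refl
  *ₚ-distribʳ-+ₚ (a ∷ p) []      r .at n = sym (trans (coeff-+ₚ ((a ∷ p) *ₚ r) [] n) (+-identityʳ _))
  *ₚ-distribʳ-+ₚ (a ∷ p) (b ∷ q) r .at n = begin
    coeff (((a + b) ∷ (p +ₚ q)) *ₚ r) n
      ≈⟨ coeff-∷-*ₚ (a + b) (p +ₚ q) r n ⟩
    (a + b) * coeff r n + coeff (0# ∷ ((p +ₚ q) *ₚ r)) n
      ≈⟨ +-congˡ (at (∷-cong (sym (+-identityˡ 0#)) (*ₚ-distribʳ-+ₚ p q r)) n) ⟩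
    (a + b) * coeff r n + coeff ((0# ∷ (p *ₚ r)) +ₚ (0# ∷ (q *ₚ r))) n
      ≈⟨ +-cong (distribʳ (coeff r n) a b) (coeff-+ₚ (0# ∷ (p *ₚ r)) (0# ∷ (q *ₚ r)) n) ⟩
    (a * coeff r n + b * coeff r n) + (coeff (0# ∷ (p *ₚ r)) n + coeff (0# ∷ (q *ₚ r)) n)
      ≈⟨ interchange _ _ _ _ ⟩
    (a * coeff r n + coeff (0# ∷ (p *ₚ r)) n) + (b * coeff r n + coeff (0# ∷ (q *ₚ r)) n)
      ≈⟨ +-cong (coeff-∷-*ₚ a p r n) (coeff-∷-*ₚ b q r n) ⟨
    coeff ((a ∷ p) *ₚ r) n + coeff ((b ∷ q) *ₚ r) n
      ≈⟨ coeff-+ₚ ((a ∷ p) *ₚ r) _ n ⟨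
    coeff (((a ∷ p) *ₚ r) +ₚ ((b ∷ q) *ₚ r)) n
      ∎

  map-*-*ₚ : ∀ a p q → map (a *_) p *ₚ q ≋ map (a *_) (p *ₚ q)
  map-*-*ₚ a []      q = ≋-refl
  map-*-*ₚ a (b ∷ p) q .at n = begin
    coeff ((a * b ∷ map (a *_) p) *ₚ q) n
      ≈⟨ coeff-∷-*ₚ (a * b) (map (a *_) p) q n ⟩
    (a * b) * coeff q n + coeff (0# ∷ (map (a *_) p *ₚ q)) n
      ≈⟨ +-cong (*-assoc a b _) (at (∷-cong (sym (zeroʳ a)) (map-*-*ₚ a p q)) n) ⟩
    a * (b * coeff q n) + coeff (map (a *_) (0# ∷ (p *ₚ q))) n
      ≈⟨ +-congˡ (coeff-map-* a (0# ∷ (p *ₚ q)) n) ⟩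
    a * (b * coeff q n) + a * coeff (0# ∷ (p *ₚ q)) n
      ≈⟨ distribˡ a _ _ ⟨
    a * (b * coeff q n + coeff (0# ∷ (p *ₚ q)) n)
      ≈⟨ *-congˡ (coeff-∷-*ₚ b p q n) ⟨
    a * coeff ((b ∷ p) *ₚ q) n
      ≈⟨ coeff-map-* a ((b ∷ p) *ₚ q) n ⟨
    coeff (map (a *_) ((b ∷ p) *ₚ q)) n
      ∎

  *ₚ-assoc : ∀ p q r → (p *ₚ q) *ₚ r ≋ p *ₚ (q *ₚ r)
  *ₚ-assoc []      q r = ≋-refl
  *ₚ-assoc (a ∷ p) q r = ≋-trans (*ₚ-distribʳ-+ₚ (map (a *_) q) (0# ∷ (p *ₚ q)) r)
    (+ₚ-cong (map-*-*ₚ a q r) (≋-trans (*ₚ-0∷ˡ (p *ₚ q) r) (∷-cong refl (*ₚ-assoc p q r))))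

  *ₚ-rightComm : ∀ p q r → (p *ₚ q) *ₚ r ≋ (p *ₚ r) *ₚ q
  *ₚ-rightComm p q r =
    ≋-trans (*ₚ-assoc p q r) (≋-trans (*ₚ-congʳ p (*ₚ-comm q r)) (≋-sym (*ₚ-assoc p r q)))

  *ₚ-shiftˡ : ∀ n p q → (replicate n 0# ++ p) *ₚ q ≋ replicate n 0# ++ (p *ₚ q)
  *ₚ-shiftˡ zero    p q = ≋-refl
  *ₚ-shiftˡ (suc n) p q = ≋-trans (*ₚ-0∷ˡ (replicate n 0# ++ p) q) (∷-cong refl (*ₚ-shiftˡ n p q))

  *ₚ-shiftʳ : ∀ n p q → p *ₚ (replicate n 0# ++ q) ≋ replicate n 0# ++ (p *ₚ q)
  *ₚ-shiftʳ zero    p q = ≋-refl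
  *ₚ-shiftʳ (suc n) p q = ≋-trans (*ₚ-0∷ʳ p (replicate n 0# ++ q)) (∷-cong refl (*ₚ-shiftʳ n p q))

  reverse-shift : ∀ n p → reverse (replicate n 0# ++ p) ≋ reverse p
  reverse-shift n p = ≋-trans (≋-reflexive (reverse-++ (replicate n 0#) p)) (++-≋[] (reverse p) (All≈0⇒≋[] zeros))
    where
    zeros : All (_≈ 0#) (reverse (replicate n 0#))
    zeros = All-resp-↭ (↭-sym (↭-reverse (replicate n 0#))) (replicate⁺ n refl)

  coeff-∷ʳ-*ₚ : ∀ p x q i →
    coeff ((p ∷ʳ x) *ₚ q) (length p +ℕ i) ≈ coeff (p *ₚ q) (length p +ℕ i) + x * coeff q i
  coeff-∷ʳ-*ₚ []      x q zero    = trans (coeff-*ₚ-zero (x ∷ []) q) (sym (+-identityˡ _))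
  coeff-∷ʳ-*ₚ []      x q (suc i) = trans (coeff-*ₚ-suc (x ∷ []) q i) (trans (+-identityʳ _) (sym (+-identityˡ _)))
  coeff-∷ʳ-*ₚ (a ∷ p) x q i = begin
    coeff ((a ∷ (p ∷ʳ x)) *ₚ q) (suc j)
      ≈⟨ coeff-*ₚ-suc (a ∷ (p ∷ʳ x)) q j ⟩
    a * coeff q (suc j) + coeff ((p ∷ʳ x) *ₚ q) j
      ≈⟨ +-congˡ (coeff-∷ʳ-*ₚ p x q i) ⟩
    a * coeff q (suc j) + (coeff (p *ₚ q) j + x * coeff q i)
      ≈⟨ +-assoc _ _ _ ⟨
    (a * coeff q (suc j) + coeff (p *ₚ q) j) + x * coeff q i
      ≈⟨ +-congʳ (coeff-*ₚ-suc (a ∷ p) q j) ⟨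
    coeff ((a ∷ p) *ₚ q) (suc j) + x * coeff q i
      ∎
    where
    j : ℕ
    j = length p +ℕ i

module Pairing {c ℓ : Level} (R : CommutativeRing c ℓ) where
  open CommutativeRing R

  dot : ∀ {n} → Vec Carrier n → (ℕ → Carrier) → Carrier
  dot []      f = 0#
  dot (x ∷ w) f = x * f 0 + dot w (f ∘ suc)

  dot-cong : ∀ {n} (w : Vec Carrier n) {f f'} → (∀ k → f k ≈ f' k) → dot w f ≈ dot w f'
  dot-cong []      f≈f' = refl
  dot-cong (x ∷ w) f≈f' = +-cong (*-congˡ (f≈f' 0)) (dot-cong w (f≈f' ∘ suc))

  dot-zeroˡ : ∀ n f → dot (Vec.replicate n 0#) f ≈ 0#
  dot-zeroˡ zero    f = refl
  dot-zeroˡ (suc n) f = trans (+-cong (zeroˡ _) (dot-zeroˡ n (f ∘ suc))) (+-identityʳ 0#)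

  basisVector : ∀ {n} → Fin n → Vec Carrier n
  basisVector {suc n} zero    = 1# ∷ Vec.replicate n 0#
  basisVector         (suc i) = 0# ∷ basisVector i

  dot-basisVector : ∀ {n} (i : Fin n) f → dot (basisVector i) f ≈ f (toℕ i)
  dot-basisVector {suc n} zero    f = trans (+-cong (*-identityˡ _) (dot-zeroˡ n (f ∘ suc))) (+-identityʳ _)
  dot-basisVector         (suc i) f = trans (+-cong (zeroˡ _) (dot-basisVector i (f ∘ suc))) (+-identityˡ _)

  dot-vanishing : ∀ {n} (w : Vec Carrier n) {f} → (∀ k → k < n → f k ≈ 0#) → dot w f ≈ 0#
  dot-vanishing []      f≈0 = refl
  dot-vanishing (x ∷ w) f≈0 = trans
    (+-cong (trans (*-congˡ (f≈0 0 z<s)) (zeroʳ x)) (dot-vanishing w (λ k k<n → f≈0 (suc k) (s<s k<n))))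
    (+-identityʳ 0#)

  dot-nondegenerate : ∀ n f → (∀ (w : Vec Carrier n) → dot w f ≈ 0#) ⇔ (∀ k → k < n → f k ≈ 0#)
  dot-nondegenerate n f = mk⇔ coefficients≈0 (λ f≈0 w → dot-vanishing w f≈0)
    where
    coefficients≈0 : (∀ (w : Vec Carrier n) → dot w f ≈ 0#) → ∀ k → k < n → f k ≈ 0#
    coefficients≈0 dot≈0 k k<n = begin
      f k                              ≡⟨ ≡.cong f (toℕ-fromℕ< k<n) ⟨
      f (toℕ i)                        ≈⟨ dot-basisVector i f ⟨
      dot (basisVector i) f            ≈⟨ dot≈0 (basisVector i) ⟩
      0#                               ∎
      where
      open import Relation.Binary.Reasoning.Setoid setoid
      i : Fin n
      i = fromℕ< k<n

module BilinearForm {c ℓ : Level} (R : CommutativeRing c ℓ) where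
  open CommutativeRing R
  module ℕ+ = CommutativeSemigroupProperties ℕ.+-commutativeSemigroup
  open Poly R
  open Polynomials R
  open Pairing R

  shift-factors-out : ∀ r P g₀ h → let g = replicate r 0# ++ g₀ in
    ((P *ₚ g) *ₚ h) *ₚ reverse g ≋ replicate r 0# ++ (((P *ₚ g₀) *ₚ reverse g₀) *ₚ h)
  shift-factors-out r P g₀ h = begin
    ((P *ₚ g) *ₚ h) *ₚ reverse g
      ≈⟨ *ₚ-congʳ ((P *ₚ g) *ₚ h) (reverse-shift r g₀) ⟩
    ((P *ₚ g) *ₚ h) *ₚ reverse g₀
      ≈⟨ *ₚ-rightComm (P *ₚ g) h (reverse g₀) ⟩
    ((P *ₚ g) *ₚ reverse g₀) *ₚ h
      ≈⟨ *ₚ-congˡ h (*ₚ-congˡ (reverse g₀) (*ₚ-shiftʳ r P g₀)) ⟩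
    ((Z ++ (P *ₚ g₀)) *ₚ reverse g₀) *ₚ h
      ≈⟨ *ₚ-congˡ h (*ₚ-shiftˡ r (P *ₚ g₀) (reverse g₀)) ⟩
    (Z ++ ((P *ₚ g₀) *ₚ reverse g₀)) *ₚ h
      ≈⟨ *ₚ-shiftˡ r ((P *ₚ g₀) *ₚ reverse g₀) h ⟩
    Z ++ (((P *ₚ g₀) *ₚ reverse g₀) *ₚ h)
      ∎
    where
    open import Relation.Binary.Reasoning.Setoid ≋-setoid
    Z g : Pol
    Z = replicate r 0#
    g = Z ++ g₀

  coeff-reverse-*ₚ : ∀ {n} (w : Vec Carrier (suc n)) q i →
    coeff (reverse (toList w) *ₚ q) (n +ℕ i) ≈ dot w (λ k → coeff q (k +ℕ i))
  coeff-reverse-*ₚ (x ∷ []) q i = trans (coeff-∷ʳ-*ₚ [] x q i) (+-comm _ _)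
  coeff-reverse-*ₚ {suc n} (x ∷ w@(_ ∷ _)) q i = begin
    coeff (reverse (x ∷ toList w) *ₚ q) (suc n +ℕ i)
      ≡⟨ ≡.cong₂ (λ u j → coeff (u *ₚ q) (j +ℕ i)) (unfold-reverse x (toList w)) (≡.sym length-p) ⟩
    coeff ((p ∷ʳ x) *ₚ q) (length p +ℕ i)
      ≈⟨ coeff-∷ʳ-*ₚ p x q i ⟩
    coeff (p *ₚ q) (length p +ℕ i) + x * coeff q i
      ≡⟨ ≡.cong (λ j → coeff (p *ₚ q) j + x * coeff q i) index≡ ⟩
    coeff (p *ₚ q) (n +ℕ suc i) + x * coeff q i
      ≈⟨ +-congʳ (coeff-reverse-*ₚ w q (suc i)) ⟩
    dot w (λ k → coeff q (k +ℕ suc i)) + x * coeff q i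
      ≈⟨ +-comm _ _ ⟩
    x * coeff q i + dot w (λ k → coeff q (k +ℕ suc i))
      ≈⟨ +-congˡ (dot-cong w (λ k → reflexive (≡.cong (coeff q) (ℕ.+-suc k i)))) ⟩
    dot (x ∷ w) (λ k → coeff q (k +ℕ i))
      ∎
    where
    open import Relation.Binary.Reasoning.Setoid setoid
    p : Pol
    p = reverse (toList w)
    length-p : length p ≡ suc n
    length-p = ≡.trans (length-reverse (toList w)) (length-toList w)
    index≡ : length p +ℕ i ≡ n +ℕ suc i
    index≡ = ≡.trans (≡.cong (_+ℕ i) length-p) (≡.sym (ℕ.+-suc n i))

  B-as-dot : ∀ m P r {e N} (g₀ : Vec Carrier (suc e)) h (w : Vec Carrier (suc N)) →
    B (laurent m P) (replicate r 0# ++ toList g₀) h (toList w)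
      ≈ dot w (λ k → coeff (((P *ₚ toList g₀) *ₚ reverse (toList g₀)) *ₚ h) (k +ℕ (e +ℕ m)))
  B-as-dot m P r {e} {N} g₀ h w = begin
    coeff (W *ₚ reverse (toList w)) index
      ≡⟨ ≡.cong (coeff (W *ₚ reverse (toList w))) index≡ ⟩
    coeff (W *ₚ reverse (toList w)) (N +ℕ (r +ℕ d))
      ≈⟨ at (*ₚ-comm W (reverse (toList w))) _ ⟩
    coeff (reverse (toList w) *ₚ W) (N +ℕ (r +ℕ d))
      ≈⟨ coeff-reverse-*ₚ w W (r +ℕ d) ⟩
    dot w (λ k → coeff W (k +ℕ (r +ℕ d)))
      ≈⟨ dot-cong w coeff-W ⟩
    dot w (λ k → coeff F (k +ℕ d))
      ∎
    where
    open import Relation.Binary.Reasoning.Setoid setoid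
    d : ℕ
    d = e +ℕ m
    Z g W F : Pol
    Z = replicate r 0#
    g = Z ++ toList g₀
    W = ((P *ₚ g) *ₚ h) *ₚ reverse g
    F = ((P *ₚ toList g₀) *ₚ reverse (toList g₀)) *ₚ h
    -- B unfolds to the coefficient of W *ₚ reverse (toList w) at this accumulated power of z⁻¹
    index : ℕ
    index = m +ℕ 0 +ℕ 0 +ℕ (length g ∸ 1) +ℕ (length (toList w) ∸ 1)
    length-g : length g ≡ suc (r +ℕ e)
    length-g = ≡.trans (length-++ Z)
      (≡.trans (≡.cong₂ _+ℕ_ (length-replicate r) (length-toList g₀)) (ℕ.+-suc r e))
    index-arithmetic : ∀ m r e N → m +ℕ 0 +ℕ 0 +ℕ (r +ℕ e) +ℕ N ≡ N +ℕ (r +ℕ (e +ℕ m))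
    index-arithmetic = solve-∀
    index≡ : index ≡ N +ℕ (r +ℕ d)
    index≡ = ≡.trans (≡.cong₂ (λ a b → m +ℕ 0 +ℕ 0 +ℕ (a ∸ 1) +ℕ (b ∸ 1)) length-g (length-toList w))
                     (index-arithmetic m r e N)
    coeff-W : ∀ k → coeff W (k +ℕ (r +ℕ d)) ≈ coeff F (k +ℕ d)
    coeff-W k = begin
      coeff W (k +ℕ (r +ℕ d))          ≈⟨ at (shift-factors-out r P (toList g₀) h) _ ⟩
      coeff (Z ++ F) (k +ℕ (r +ℕ d))   ≡⟨ ≡.cong (coeff (Z ++ F)) (ℕ+.x∙yz≈y∙xz k r d) ⟩
      coeff (Z ++ F) (r +ℕ (k +ℕ d))   ≡⟨ coeff-replicate-++ r 0# F (k +ℕ d) ⟩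
      coeff F (k +ℕ d)                 ∎

  radical⇔coefficients : ∀ m P r {e N} (g₀ : Vec Carrier (suc e)) h →
    (∀ (w : Vec Carrier (suc N)) → B (laurent m P) (replicate r 0# ++ toList g₀) h (toList w) ≈ 0#)
      ⇔ (∀ k → k < suc N → coeff (((P *ₚ toList g₀) *ₚ reverse (toList g₀)) *ₚ h) (k +ℕ (e +ℕ m)) ≈ 0#)
  radical⇔coefficients m P r g₀ h = dot-nondegenerate _ _ ⇔-∘ mk⇔
    (λ B≈0 w → trans (sym (B-as-dot m P r g₀ h w)) (B≈0 w))
    (λ dot≈0 w → trans (B-as-dot m P r g₀ h w) (dot≈0 w))

∀-offset⇔∀-range : ∀ {p} {P : ℕ → Set p} a n →
  (∀ k → k < suc n → P (k +ℕ a)) ⇔ (∀ j → a ≤ j → j ≤ a +ℕ n → P j)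
∀-offset⇔∀-range {P = P} a n = mk⇔
  (λ P-offset j a≤j j≤a+n →
    ≡.subst P (ℕ.m∸n+n≡m a≤j) (P-offset (j ∸ a) (s≤s (ℕ.m≤n+o⇒m∸n≤o j a j≤a+n))))
  (λ P-range k k<1+n →
    P-range (k +ℕ a) (ℕ.m≤n+m a k)
      (≡.subst (_≤ a +ℕ n) (ℕ.+-comm a k) (ℕ.+-monoʳ-≤ a (ℕ.≤-pred k<1+n))))

lemma5p1 : ∀ {c ℓ : Level} (R : CommutativeRing c ℓ) → IsFiniteField R →
    let open CommutativeRing R in let open Poly R in
    (half : Carrier) → (1# + 1#) * half ≈ 1# →
    (m : ℕ) (c₀ : Carrier) (cs : Vec Carrier m) → ¬ (last (c₀ ∷ cs) ≈ 0#) →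
    (r e : ℕ) (g₀ : Vec Carrier (suc e)) → ¬ (head g₀ ≈ 0#) → ¬ (last g₀ ≈ 0#) →
    (N : ℕ) (h : Vec Carrier (suc N)) →
    ((∀ (w : Vec Carrier (suc N)) →
        B (Alaurent m half c₀ cs) (gpol r g₀) (vpol h) (vpol w) ≈ 0#)
     → (∀ j → e +ℕ m ≤ j → j ≤ e +ℕ m +ℕ N →
        coeff (((Pcoeffs half c₀ cs *ₚ vpol g₀) *ₚ star (vpol g₀)) *ₚ vpol h) j ≈ 0#))
    × ((∀ j → e +ℕ m ≤ j → j ≤ e +ℕ m +ℕ N →
        coeff (((Pcoeffs half c₀ cs *ₚ vpol g₀) *ₚ star (vpol g₀)) *ₚ vpol h) j ≈ 0#)
     → (∀ (w : Vec Carrier (suc N)) →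
        B (Alaurent m half c₀ cs) (gpol r g₀) (vpol h) (vpol w) ≈ 0#))
lemma5p1 R _ half _ m c₀ cs _ r e g₀ _ _ N h = Equivalence.to radical⇔ , Equivalence.from radical⇔
  where
  open CommutativeRing R
  open Poly R
  radical⇔ : (∀ (w : Vec Carrier (suc N)) → B (Alaurent m half c₀ cs) (gpol r g₀) (vpol h) (vpol w) ≈ 0#)
    ⇔ (∀ j → e +ℕ m ≤ j → j ≤ e +ℕ m +ℕ N →
         coeff (((Pcoeffs half c₀ cs *ₚ vpol g₀) *ₚ star (vpol g₀)) *ₚ vpol h) j ≈ 0#)
  radical⇔ = ∀-offset⇔∀-range (e +ℕ m) N
    ⇔-∘ BilinearForm.radical⇔coefficients R m (Pcoeffs half c₀ cs) r g₀ (vpol h)
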